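{- For all integers $m,d\ge 2$, writing $N=|V(F_{m,d})|=\frac{m^{d+1}-1}{m-1}$, we have (1) $\mathrm{irr}(F_{m,d})=m+m^{d+1}$, and (2) $\mathrm{Mo}(F_{m,d})=N^2-N-2d\left(N+\frac{1}{m-1}\right)+\frac{2}{m-1}(N-1)$.
   Context: $F_{m,d}$ denotes the full $m$-ary tree of depth $d$: a rooted tree in which every non-leaf vertex has exactly $m$ children and all leaves are at depth $d$. For a graph $G$, $\mathrm{irr}(G)=\sum_{\{u,v\}\in E(G)}|d_u-d_v|$ where $d_v$ is the degree of $v$. Let $n_G(u,v)$ be the number of vertices strictly closer to $u$ than to $v$; the Mostar index is $\mathrm{Mo}(G)=\sum_{\{u,v\}\in E(G)}|n_G(u,v)-n_G(v,u)|$. -}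

module Defs where

open import Data.Bool using (Bool; true; false; _∧_; _∨_; if_then_else_)
open import Data.Nat using (ℕ; zero; suc; _+_; _*_; _<ᵇ_; ∣_-_∣)
open import Data.Fin using (Fin)
import Data.Fin as Fin
open import Data.Product using (_×_; _,_)
open import Data.List using (List; []; _∷_; _++_; map; concatMap; length; allFin)
open import Data.Bool.ListAction using (any)
open import Data.Nat.ListAction using (sum)
import Data.List.Properties as LP
open import Relation.Nullary.Decidable using (⌊_⌋)

-- Finite simple graphs, given by an explicit duplicate-free list of
-- vertices and a (symmetric, irreflexive) Boolean adjacency relation.

record Graph : Set₁ where
  field
    V     : Set
    verts : List V
    adj   : V → V → Bool
open Graph public

order : Graph → ℕ
order G = length (verts G)

countB : {A : Set} → (A → Bool) → List A → ℕ
countB p [] = 0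
countB p (x ∷ xs) = (if p x then 1 else 0) + countB p xs

keep : {A : Set} → (A → Bool) → List A → List A
keep p [] = []
keep p (x ∷ xs) = if p x then x ∷ keep p xs else keep p xs

degree : (G : Graph) → V G → ℕ
degree G v = countB (adj G v) (verts G)

pairs : {A : Set} → List A → List (A × A)
pairs [] = []
pairs (x ∷ xs) = map (x ,_) xs ++ pairs xs

edges : (G : Graph) → List (V G × V G)
edges G = keep (λ { (u , v) → adj G u v }) (pairs (verts G))

module _ (G : Graph) (eq : V G → V G → Bool) where
  reach : ℕ → V G → V G → Bool
  reach zero u v = eq u v
  reach (suc k) u v = reach k u v ∨ any (λ w → adj G u w ∧ reach k w v) (verts G)

  -- distance: least k ≤ |V(G)| with reach k u v (|V(G)| if none;
  -- irrelevant for connected graphs, where dist < |V(G)| always)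
  distFrom : ℕ → ℕ → V G → V G → ℕ
  distFrom k zero u v = k
  distFrom k (suc fuel) u v = if reach k u v then k else distFrom (suc k) fuel u v

  dist : V G → V G → ℕ
  dist u v = distFrom 0 (order G) u v

  nG : V G → V G → ℕ
  nG u v = countB (λ w → dist w u <ᵇ dist w v) (verts G)

  Mo : ℕ
  Mo = sum (map (λ { (u , v) → ∣ nG u v - nG v u ∣ }) (edges G))

irr : Graph → ℕ
irr G = sum (map (λ { (u , v) → ∣ degree G u - degree G v ∣ }) (edges G))

-- The full m-ary tree F_{m,d}.
-- Vertices: words over Fin m of length ≤ d (the root is the empty word;
-- the children of w are a ∷ w for a : Fin m).

words : (m : ℕ) → ℕ → List (List (Fin m))
words m zero = [] ∷ []
words m (suc k) = concatMap (λ w → map (_∷ w) (allFin m)) (words m k)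

wordsUpTo : (m : ℕ) → ℕ → List (List (Fin m))
wordsUpTo m zero = words m zero
wordsUpTo m (suc d) = wordsUpTo m d ++ words m (suc d)

eqW : {m : ℕ} → List (Fin m) → List (Fin m) → Bool
eqW u v = ⌊ LP.≡-dec Fin._≟_ u v ⌋

childOf : {m : ℕ} → List (Fin m) → List (Fin m) → Bool
childOf u [] = false
childOf u (a ∷ v) = eqW u v

F : (m d : ℕ) → Graph
F m d = record
  { V = List (Fin m)
  ; verts = wordsUpTo m d
  ; adj = λ u v → childOf u v ∨ childOf v u
  }

MoF : (m d : ℕ) → ℕ
MoF m d = Mo (F m d) eqW

module Submission where

-- The vertices of F_{m,d} are the words over Fin m of length at most d, a child being
-- obtained by consing a letter. Moving one end of a path one edge away from the root
-- changes its length by -1 or +1 according as the other end lies below that edge, which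
-- identifies the graph distance with an explicit tree distance. Consequently, across the
-- edge from a vertex at depth k-1 to its child, the child's side is exactly the child's
-- subtree, of size S_k = 1 + m + ⋯ + m^(d-k), and the parent's side has N - S_k vertices.
-- Each edge is a parent-child pair, so both indices become sums over depths:
-- Mo = Σ_{k=1}^{d} m^k (N - 2 S_k), while irr only collects |m - (m+1)| = 1 on the m root
-- edges and |(m+1) - 1| = m on the m^d leaf edges. Multiplying by m - 1 turns the
-- geometric sums N and S_k into powers of m, which gives the closed forms.

open import Defs

module FullTree where

  open import Data.Bool using (Bool; true; false; _∧_; _∨_; if_then_else_; not)
  open import Data.Bool.Properties using (∨-zeroʳ; T-≡)
  open import Data.Bool.ListAction using (any)
  open import Data.Empty using (⊥-elim)
  open import Data.Fin using (Fin)
  import Data.Fin as Fin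
  import Data.Fin.Properties as Finₚ
  open import Data.List using (List; []; _∷_; _++_; map; length; concatMap; allFin; tabulate)
  import Data.List.Properties as List
  open import Data.List.Membership.Propositional using (_∈_)
  open import Data.List.Membership.Propositional.Properties
    using (∈-concat⁻′; ∈-concat⁺′; ∈-map⁻; ∈-map⁺; ∈-allFin; ∈-++⁻; ∈-++⁺ˡ; ∈-++⁺ʳ)
  open import Data.List.Relation.Unary.Any using (here; there)
  open import Data.Nat
    using (ℕ; zero; suc; _+_; _*_; _∸_; _^_; _≤_; _<_; z≤n; s≤s; z<s; pred; _≤?_; _<ᵇ_; ∣_-_∣; NonZero; ≢-nonZero; >-nonZero)
  open import Data.Nat.ListAction using (sum)
  open import Data.Nat.Properties
  open import Data.Nat.Tactic.RingSolver using (solve-∀)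
  open import Data.Product using (∃; _×_; _,_; proj₁; proj₂)
  open import Data.Sum using (_⊎_; inj₁; inj₂)
  open import Function using (_∘_; id; Equivalence)
  open import Relation.Nullary using (Dec; yes; no; does)
  open import Relation.Nullary.Decidable using (dec-true; dec-false; isYes≗does)
  open import Relation.Binary.PropositionalEquality

  private variable
    A B : Set

  boolToℕ : Bool → ℕ
  boolToℕ b = if b then 1 else 0

  ∨≡true⁻ : ∀ {x y} → x ∨ y ≡ true → x ≡ true ⊎ y ≡ true
  ∨≡true⁻ {true} _ = inj₁ refl
  ∨≡true⁻ {false} e = inj₂ e

  ∧≡true⁻ : ∀ {x y} → x ∧ y ≡ true → x ≡ true × y ≡ true
  ∧≡true⁻ {true} {true} _ = refl , refl

  <⇒<ᵇ≡true : ∀ {m n} → m < n → (m <ᵇ n) ≡ true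
  <⇒<ᵇ≡true m<n = Equivalence.to T-≡ (<⇒<ᵇ m<n)

  ≥⇒<ᵇ≡false : ∀ {m n} → n ≤ m → (m <ᵇ n) ≡ false
  ≥⇒<ᵇ≡false {m} {n} n≤m with m <ᵇ n in eq
  ... | false = refl
  ... | true = ⊥-elim (≤⇒≯ n≤m (<ᵇ⇒< m n (Equivalence.from T-≡ eq)))

  any≡true⁺ : (p : A → Bool) {x : A} {xs : List A} → x ∈ xs → p x ≡ true → any p xs ≡ true
  any≡true⁺ p (here refl) px rewrite px = refl
  any≡true⁺ p {xs = y ∷ ys} (there x∈ys) px rewrite any≡true⁺ p x∈ys px = ∨-zeroʳ (p y)

  any≡true⁻ : (p : A → Bool) (xs : List A) → any p xs ≡ true → ∃ λ x → x ∈ xs × p x ≡ true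
  any≡true⁻ p (x ∷ xs) e with p x in px
  ... | true = x , here refl , px
  ... | false with any≡true⁻ p xs e
  ...   | y , y∈xs , py = y , there y∈xs , py

  countB-not+countB : (p : A → Bool) (xs : List A) → countB (not ∘ p) xs + countB p xs ≡ length xs
  countB-not+countB p [] = refl
  countB-not+countB p (x ∷ xs) with p x
  ... | true = trans (+-suc _ _) (cong suc (countB-not+countB p xs))
  ... | false = cong suc (countB-not+countB p xs)

  countB-∨-disjoint : (p q : A → Bool) (xs : List A) → (∀ x → p x ≡ true → q x ≡ false) →
    countB (λ x → p x ∨ q x) xs ≡ countB p xs + countB q xs
  countB-∨-disjoint p q [] _ = refl
  countB-∨-disjoint p q (x ∷ xs) disj with p x in px
  ... | true rewrite disj x px = cong suc (countB-∨-disjoint p q xs disj)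
  ... | false with q x
  ...   | true = trans (cong suc (countB-∨-disjoint p q xs disj)) (sym (+-suc _ _))
  ...   | false = countB-∨-disjoint p q xs disj

  sumBy : (A → ℕ) → List A → ℕ
  sumBy f [] = 0
  sumBy f (x ∷ xs) = f x + sumBy f xs

  sum-map≡sumBy : (f : A → ℕ) (xs : List A) → sum (map f xs) ≡ sumBy f xs
  sum-map≡sumBy f [] = refl
  sum-map≡sumBy f (x ∷ xs) = cong (f x +_) (sum-map≡sumBy f xs)

  countB≡sumBy : (p : A → Bool) (xs : List A) → countB p xs ≡ sumBy (boolToℕ ∘ p) xs
  countB≡sumBy p [] = refl
  countB≡sumBy p (x ∷ xs) = cong (boolToℕ (p x) +_) (countB≡sumBy p xs)

  sumBy-++ : (f : A → ℕ) (xs ys : List A) → sumBy f (xs ++ ys) ≡ sumBy f xs + sumBy f ys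
  sumBy-++ f [] ys = refl
  sumBy-++ f (x ∷ xs) ys = trans (cong (f x +_) (sumBy-++ f xs ys)) (sym (+-assoc (f x) _ _))

  sumBy-cong : {f g : A → ℕ} (xs : List A) → (∀ x → x ∈ xs → f x ≡ g x) → sumBy f xs ≡ sumBy g xs
  sumBy-cong [] _ = refl
  sumBy-cong (x ∷ xs) f≗g = cong₂ _+_ (f≗g x (here refl)) (sumBy-cong xs (λ y y∈xs → f≗g y (there y∈xs)))

  sumBy-zero : (f : A → ℕ) (xs : List A) → (∀ x → x ∈ xs → f x ≡ 0) → sumBy f xs ≡ 0
  sumBy-zero f [] _ = refl
  sumBy-zero f (x ∷ xs) f≗0 = cong₂ _+_ (f≗0 x (here refl)) (sumBy-zero f xs (λ y y∈xs → f≗0 y (there y∈xs)))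

  sumBy-+ : (f g : A → ℕ) (xs : List A) → sumBy (λ x → f x + g x) xs ≡ sumBy f xs + sumBy g xs
  sumBy-+ f g [] = refl
  sumBy-+ f g (x ∷ xs) rewrite sumBy-+ f g xs = interchange (f x) (g x) (sumBy f xs) (sumBy g xs)
    where
      interchange : ∀ a b c d → a + b + (c + d) ≡ a + c + (b + d)
      interchange = solve-∀

  sumBy-* : (c : ℕ) (f : A → ℕ) (xs : List A) → sumBy (λ x → c * f x) xs ≡ c * sumBy f xs
  sumBy-* c f [] = sym (*-zeroʳ c)
  sumBy-* c f (x ∷ xs) rewrite sumBy-* c f xs = sym (*-distribˡ-+ c (f x) _)

  sumBy-const : (c : ℕ) (xs : List A) → sumBy (λ _ → c) xs ≡ length xs * c
  sumBy-const c [] = refl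
  sumBy-const c (x ∷ xs) = cong (c +_) (sumBy-const c xs)

  sumBy-map : (f : B → ℕ) (g : A → B) (xs : List A) → sumBy f (map g xs) ≡ sumBy (f ∘ g) xs
  sumBy-map f g [] = refl
  sumBy-map f g (x ∷ xs) = cong (f (g x) +_) (sumBy-map f g xs)

  sumBy-concatMap : (f : B → ℕ) (g : A → List B) (xs : List A) →
    sumBy f (concatMap g xs) ≡ sumBy (sumBy f ∘ g) xs
  sumBy-concatMap f g [] = refl
  sumBy-concatMap f g (x ∷ xs) =
    trans (sumBy-++ f (g x) (concatMap g xs)) (cong (sumBy f (g x) +_) (sumBy-concatMap f g xs))

  sumBy-keep : (p : A → Bool) (f : A → ℕ) (xs : List A) →
    sumBy f (keep p xs) ≡ sumBy (λ x → if p x then f x else 0) xs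
  sumBy-keep p f [] = refl
  sumBy-keep p f (x ∷ xs) with p x
  ... | true = cong (f x +_) (sumBy-keep p f xs)
  ... | false = sumBy-keep p f xs

  sumBy-swap : (φ : A → B → ℕ) (xs : List A) (ys : List B) →
    sumBy (λ x → sumBy (φ x) ys) xs ≡ sumBy (λ y → sumBy (λ x → φ x y) xs) ys
  sumBy-swap φ [] ys = sym (sumBy-zero _ ys (λ _ _ → refl))
  sumBy-swap φ (x ∷ xs) ys rewrite sumBy-swap φ xs ys = sym (sumBy-+ (φ x) (λ y → sumBy (λ x → φ x y) xs) ys)

  sumBy-allFin-single : ∀ n (g : Fin n → Bool) (a : Fin n) → g a ≡ true → (∀ b → g b ≡ true → b ≡ a) →
    sumBy (boolToℕ ∘ g) (allFin n) ≡ 1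
  sumBy-allFin-single (suc n) g a ga only-a = trans (cong (boolToℕ (g Fin.zero) +_) shift) (split a ga only-a)
    where
      shift : sumBy (boolToℕ ∘ g) (tabulate Fin.suc) ≡ sumBy (boolToℕ ∘ g ∘ Fin.suc) (allFin n)
      shift = trans (cong (sumBy (boolToℕ ∘ g)) (sym (List.map-tabulate id Fin.suc)))
                    (sumBy-map (boolToℕ ∘ g) Fin.suc (allFin n))
      split : ∀ a → g a ≡ true → (∀ b → g b ≡ true → b ≡ a) →
        boolToℕ (g Fin.zero) + sumBy (boolToℕ ∘ g ∘ Fin.suc) (allFin n) ≡ 1
      split Fin.zero ga only-0 rewrite ga = cong suc (sumBy-zero _ (allFin n) (λ b _ → off b))
        where
          off : ∀ b → boolToℕ (g (Fin.suc b)) ≡ 0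
          off b with g (Fin.suc b) in gb
          ... | false = refl
          ... | true with only-0 (Fin.suc b) gb
          ...   | ()
      split (Fin.suc a) ga only-sa with g Fin.zero in g0
      ... | true with only-sa Fin.zero g0
      ...   | ()
      split (Fin.suc a) ga only-sa | false =
        sumBy-allFin-single n (g ∘ Fin.suc) a ga (λ b gb → Finₚ.suc-injective (only-sa (Fin.suc b) gb))

  sumBy-pairs : {X : Set} (φ : X → X → ℕ) (xs : List X) →
    sumBy (λ { (x , y) → φ x y + φ y x }) (pairs xs) + sumBy (λ x → φ x x) xs
      ≡ sumBy (λ x → sumBy (φ x) xs) xs
  sumBy-pairs φ [] = refl
  sumBy-pairs {X} φ (x ∷ xs) = begin
      sumBy sym-φ (map (x ,_) xs ++ pairs xs) + (φ x x + D)
        ≡⟨ cong (_+ (φ x x + D)) (sumBy-++ sym-φ (map (x ,_) xs) (pairs xs)) ⟩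
      (sumBy sym-φ (map (x ,_) xs) + P) + (φ x x + D)
        ≡⟨ cong (λ t → (t + P) + (φ x x + D)) (trans (sumBy-map sym-φ (x ,_) xs) (sumBy-+ (φ x) (λ y → φ y x) xs)) ⟩
      ((Row + Col) + P) + (φ x x + D)
        ≡⟨ regroup Row Col P (φ x x) D ⟩
      (φ x x + Row) + (Col + (P + D))
        ≡⟨ cong (λ t → (φ x x + Row) + (Col + t)) (sumBy-pairs φ xs) ⟩
      (φ x x + Row) + (Col + sumBy (λ z → sumBy (φ z) xs) xs)
        ≡⟨ cong ((φ x x + Row) +_) (sym (sumBy-+ (λ z → φ z x) (λ z → sumBy (φ z) xs) xs)) ⟩
      (φ x x + Row) + sumBy (λ z → φ z x + sumBy (φ z) xs) xs ∎
    where
      open ≡-Reasoning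
      sym-φ : X × X → ℕ
      sym-φ (x , y) = φ x y + φ y x
      P D Row Col : ℕ
      P = sumBy sym-φ (pairs xs)
      D = sumBy (λ z → φ z z) xs
      Row = sumBy (φ x) xs
      Col = sumBy (λ y → φ y x) xs
      regroup : ∀ a b p c d → ((a + b) + p) + (c + d) ≡ (c + a) + (b + (p + d))
      regroup = solve-∀

  sum-keep-pairs : {X : Set} (xs : List X) (c : X → X → Bool) (p : X × X → Bool) (h : X × X → ℕ) →
    (∀ x y → p (x , y) ≡ c x y ∨ c y x) → (∀ x y → h (x , y) ≡ h (y , x)) →
    (∀ x y → c x y ≡ true → c y x ≡ false) → (∀ x → c x x ≡ false) →
    sum (map h (keep p (pairs xs)))
      ≡ sumBy (λ x → sumBy (λ y → if c x y then h (x , y) else 0) xs) xs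
  sum-keep-pairs {X} xs c p h p≡ h-sym c-asym c-irrefl = begin
      sum (map h (keep p (pairs xs)))
        ≡⟨ trans (sum-map≡sumBy h (keep p (pairs xs))) (sumBy-keep p h (pairs xs)) ⟩
      sumBy (λ q → if p q then h q else 0) (pairs xs)
        ≡⟨ sumBy-cong (pairs xs) (λ q _ → split q) ⟩
      sumBy (λ { (x , y) → φ x y + φ y x }) (pairs xs)
        ≡⟨ sym (+-identityʳ _) ⟩
      sumBy (λ { (x , y) → φ x y + φ y x }) (pairs xs) + 0
        ≡⟨ cong (sumBy (λ { (x , y) → φ x y + φ y x }) (pairs xs) +_) (sym (sumBy-zero _ xs (λ x _ → diagonal x))) ⟩
      sumBy (λ { (x , y) → φ x y + φ y x }) (pairs xs) + sumBy (λ x → φ x x) xs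
        ≡⟨ sumBy-pairs φ xs ⟩
      sumBy (λ x → sumBy (φ x) xs) xs ∎
    where
      open ≡-Reasoning
      φ : X → X → ℕ
      φ x y = if c x y then h (x , y) else 0
      diagonal : ∀ x → φ x x ≡ 0
      diagonal x rewrite c-irrefl x = refl
      split : ∀ q → (if p q then h q else 0) ≡ φ (proj₁ q) (proj₂ q) + φ (proj₂ q) (proj₁ q)
      split (x , y) rewrite p≡ x y with c x y in cxy | c y x in cyx
      ... | true | false = sym (+-identityʳ _)
      ... | false | true = h-sym x y
      ... | false | false = refl
      ... | true | true with trans (sym (c-asym x y cxy)) cyx
      ...   | ()

  -- Words and the tree distance

  Word : ℕ → Set
  Word m = List (Fin m)

  towards : Bool → ℕ → ℕ
  towards true n = pred n
  towards false n = suc n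

  towards-<ᵇ : (b : Bool) (n : ℕ) → (b ≡ true → n ≢ 0) → (towards b n <ᵇ n) ≡ b
  towards-<ᵇ true zero 0≢0 = ⊥-elim (0≢0 refl refl)
  towards-<ᵇ true (suc n) _ = <⇒<ᵇ≡true (n<1+n n)
  towards-<ᵇ false n _ = ≥⇒<ᵇ≡false (n≤1+n n)

  <ᵇ-towards : (b : Bool) (n : ℕ) → (n <ᵇ towards b n) ≡ not b
  <ᵇ-towards true n = ≥⇒<ᵇ≡false {n} {pred n} pred[n]≤n
  <ᵇ-towards false n = <⇒<ᵇ≡true (n<1+n n)

  module _ {m : ℕ} where

    infix 4 _≟ʷ_
    _≟ʷ_ : (u v : Word m) → Dec (u ≡ v)
    _≟ʷ_ = List.≡-dec Fin._≟_

    eqW≡does : (u v : Word m) → eqW u v ≡ does (u ≟ʷ v)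
    eqW≡does u v = isYes≗does (u ≟ʷ v)

    eqW-refl : (u : Word m) → eqW u u ≡ true
    eqW-refl u = trans (eqW≡does u u) (dec-true (u ≟ʷ u) refl)

    eqW-≢ : {u v : Word m} → u ≢ v → eqW u v ≡ false
    eqW-≢ {u} {v} u≢v = trans (eqW≡does u v) (dec-false (u ≟ʷ v) u≢v)

    eqW⇒≡ : {u v : Word m} → eqW u v ≡ true → u ≡ v
    eqW⇒≡ {u} {v} e with u ≟ʷ v
    ... | yes u≡v = u≡v

    eqW-sym : (u v : Word m) → eqW u v ≡ eqW v u
    eqW-sym u v with u ≟ʷ v
    ... | yes refl = sym (eqW-refl u)
    ... | no u≢v = sym (eqW-≢ (u≢v ∘ sym))

    -- Children are formed by consing, so u ≼ w (w lies in the subtree rooted at u)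
    -- means that u is a suffix of w.
    infix 4 _≼_ _≼?_
    data _≼_ (u : Word m) : Word m → Set where
      ≼-refl : u ≼ u
      ≼-∷ : ∀ {a w} → u ≼ w → u ≼ a ∷ w

    _≼?_ : (u w : Word m) → Dec (u ≼ w)
    u ≼? [] with u ≟ʷ []
    ... | yes refl = yes ≼-refl
    ... | no u≢[] = no λ { ≼-refl → u≢[] refl }
    u ≼? (b ∷ w) with u ≟ʷ b ∷ w | u ≼? w
    ... | yes refl | _ = yes ≼-refl
    ... | no _ | yes u≼w = yes (≼-∷ u≼w)
    ... | no u≢bw | no u⋠w = no λ { ≼-refl → u≢bw refl ; (≼-∷ u≼w) → u⋠w u≼w }

    []≼ : (w : Word m) → [] ≼ w
    []≼ [] = ≼-refl
    []≼ (b ∷ w) = ≼-∷ ([]≼ w)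

    ≼⇒length≤ : {u w : Word m} → u ≼ w → length u ≤ length w
    ≼⇒length≤ ≼-refl = ≤-refl
    ≼⇒length≤ (≼-∷ u≼w) = m≤n⇒m≤1+n (≼⇒length≤ u≼w)

    ≼∧length≡⇒≡ : {u w : Word m} → u ≼ w → length u ≡ length w → u ≡ w
    ≼∧length≡⇒≡ ≼-refl _ = refl
    ≼∧length≡⇒≡ (≼-∷ u≼w) e = ⊥-elim (<-irrefl e (s≤s (≼⇒length≤ u≼w)))

    ∷≼⇒≼ : {a : Fin m} {u w : Word m} → a ∷ u ≼ w → u ≼ w
    ∷≼⇒≼ ≼-refl = ≼-∷ ≼-refl
    ∷≼⇒≼ (≼-∷ s) = ≼-∷ (∷≼⇒≼ s)

    ≼-∷⁻ : {u w : Word m} {b : Fin m} → u ≼ b ∷ w → length u ≤ length w → u ≼ w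
    ≼-∷⁻ ≼-refl le = ⊥-elim (<-irrefl refl le)
    ≼-∷⁻ (≼-∷ u≼w) _ = u≼w

    ≼∧≢⇒child≼ : {u w : Word m} → u ≼ w → u ≢ w → ∃ λ a → a ∷ u ≼ w
    ≼∧≢⇒child≼ ≼-refl u≢w = ⊥-elim (u≢w refl)
    ≼∧≢⇒child≼ {u} (≼-∷ {b} {w} u≼w) _ with u ≟ʷ w
    ... | yes refl = b , ≼-refl
    ... | no u≢w with ≼∧≢⇒child≼ u≼w u≢w
    ...   | a , au≼w = a , ≼-∷ au≼w

    ≼?-sameLength : (u w : Word m) → length w ≡ length u → does (u ≼? w) ≡ eqW u w
    ≼?-sameLength u w e with u ≟ʷ w
    ... | yes refl = dec-true (u ≼? u) ≼-refl
    ... | no u≢w = dec-false (u ≼? w) (λ u≼w → u≢w (≼∧length≡⇒≡ u≼w (sym e)))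

    -- The distance from a ∷ u to v is one less than from its parent u exactly when v lies
    -- below a ∷ u; at the root it is the depth of v.
    treeDist : Word m → Word m → ℕ
    treeDist [] v = length v
    treeDist (a ∷ u) v = towards (does (a ∷ u ≼? v)) (treeDist u v)

    treeDist-≼ : {u v : Word m} → u ≼ v → treeDist u v ≡ length v ∸ length u
    treeDist-≼ {[]} _ = refl
    treeDist-≼ {a ∷ u} {v} au≼v = begin
        towards (does (a ∷ u ≼? v)) (treeDist u v) ≡⟨ cong (λ b → towards b (treeDist u v)) (dec-true (a ∷ u ≼? v) au≼v) ⟩
        pred (treeDist u v)                         ≡⟨ cong pred (treeDist-≼ (∷≼⇒≼ au≼v)) ⟩
        pred (length v ∸ length u)                  ≡⟨ pred[m∸n]≡m∸[1+n] (length v) (length u) ⟩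
        length v ∸ suc (length u)                   ∎
      where open ≡-Reasoning

    treeDist-self : (u : Word m) → treeDist u u ≡ 0
    treeDist-self u = trans (treeDist-≼ {u} {u} ≼-refl) (n∸n≡0 (length u))

    treeDist≡0⇒≡ : {u v : Word m} → treeDist u v ≡ 0 → u ≡ v
    treeDist≡0⇒≡ {u} {v} e with u ≼? v
    ... | yes u≼v = ≼∧length≡⇒≡ u≼v (≤-antisym (≼⇒length≤ u≼v) (m∸n≡0⇒m≤n (trans (sym (treeDist-≼ u≼v)) e)))
    treeDist≡0⇒≡ {[]} {v} e | no []⋠v = ⊥-elim ([]⋠v ([]≼ v))
    treeDist≡0⇒≡ {a ∷ u} {v} e | no au⋠v
      with trans (sym (cong (λ b → towards b (treeDist u v)) (dec-false (a ∷ u ≼? v) au⋠v))) e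
    ... | ()

    treeDist≤ : (u v : Word m) → treeDist u v ≤ length u + length v
    treeDist≤ [] v = ≤-refl
    treeDist≤ (a ∷ u) v with does (a ∷ u ≼? v)
    ... | true = ≤-trans pred[n]≤n (m≤n⇒m≤1+n (treeDist≤ u v))
    ... | false = s≤s (treeDist≤ u v)

    treeDist-child : (u : Word m) (a : Fin m) (v : Word m) →
      treeDist u (a ∷ v) ≡ towards (does (a ∷ v ≼? u)) (treeDist u v)
    treeDist-child [] a v = cong (λ b → towards b (length v)) (sym (dec-false (a ∷ v ≼? []) λ ()))
    treeDist-child (b ∷ u) a v rewrite treeDist-child u a v =
      commute (b ∷ u ≼? a ∷ v) (a ∷ v ≼? u) (a ∷ v ≼? b ∷ u) (b ∷ u ≼? v)
      where
        t : ℕ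
        t = treeDist u v
        longer⇒≢ : {x y : Word m} → length x < length y → treeDist x y ≢ 0
        longer⇒≢ {x} {y} lt e = <-irrefl (cong length (treeDist≡0⇒≡ {x} {y} e)) lt
        shorter⇒≢ : {x y : Word m} → length y < length x → treeDist x y ≢ 0
        shorter⇒≢ {x} {y} lt e = <-irrefl (cong length (sym (treeDist≡0⇒≡ {x} {y} e))) lt
        suc-pred-t : t ≢ 0 → suc (pred t) ≡ t
        suc-pred-t t≢0 = suc-pred t {{≢-nonZero t≢0}}
        impossible : {x w : Word m} → x ≼ w → length w < length x → {C : Set} → C
        impossible x≼w lt = ⊥-elim (<⇒≱ lt (≼⇒length≤ x≼w))
        -- moving the first word up and the second word down commute
        commute : (P : Dec (b ∷ u ≼ a ∷ v)) (Q : Dec (a ∷ v ≼ u)) (R : Dec (a ∷ v ≼ b ∷ u)) (S : Dec (b ∷ u ≼ v)) →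
          towards (does P) (towards (does Q) t) ≡ towards (does R) (towards (does S) t)
        commute (yes ≼-refl) (yes Q) R S = impossible Q (n<1+n _)
        commute (yes ≼-refl) (no _) (yes _) (yes S) = impossible S (n<1+n _)
        commute (yes ≼-refl) (no _) (yes _) (no _) = refl
        commute (yes ≼-refl) (no _) (no ¬R) S = ⊥-elim (¬R ≼-refl)
        commute (yes (≼-∷ P)) (yes Q) R S = impossible Q (s≤s (≼⇒length≤ (∷≼⇒≼ P)))
        commute (yes (≼-∷ P)) (no _) (yes R) S = impossible R (s≤s (≼⇒length≤ P))
        commute (yes (≼-∷ P)) (no _) (no _) (no ¬S) = ⊥-elim (¬S P)
        commute (yes (≼-∷ P)) (no _) (no _) (yes _) = sym (suc-pred-t (longer⇒≢ {u} {v} (≼⇒length≤ P)))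
        commute (no ¬P) Q R (yes S) = ⊥-elim (¬P (≼-∷ S))
        commute (no ¬P) (yes Q) (no ¬R) (no _) = ⊥-elim (¬R (≼-∷ Q))
        commute (no ¬P) (yes Q) (yes _) (no _) = suc-pred-t (shorter⇒≢ {u} {v} (≼⇒length≤ Q))
        commute (no ¬P) (no _) (yes ≼-refl) (no _) = ⊥-elim (¬P ≼-refl)
        commute (no ¬P) (no ¬Q) (yes (≼-∷ R)) (no _) = ⊥-elim (¬Q R)
        commute (no ¬P) (no _) (no _) (no _) = refl

    ∈words⇒length : ∀ {k} {w : Word m} → w ∈ words m k → length w ≡ k
    ∈words⇒length {zero} (here refl) = refl
    ∈words⇒length {suc k} {w} w∈ with ∈-concat⁻′ (map (λ x → map (_∷ x) (allFin m)) (words m k)) w∈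
    ... | xs , w∈xs , xs∈ with ∈-map⁻ (λ x → map (_∷ x) (allFin m)) xs∈
    ...   | x , x∈ , refl with ∈-map⁻ (_∷ x) w∈xs
    ...     | a , _ , refl = cong suc (∈words⇒length x∈)

    ∈-words : (w : Word m) → w ∈ words m (length w)
    ∈-words [] = here refl
    ∈-words (a ∷ w) = ∈-concat⁺′ (∈-map⁺ (_∷ w) (∈-allFin a)) (∈-map⁺ (λ x → map (_∷ x) (allFin m)) (∈-words w))

    ∈wordsUpTo⇒length≤ : ∀ {d} {w : Word m} → w ∈ wordsUpTo m d → length w ≤ d
    ∈wordsUpTo⇒length≤ {zero} w∈ = ≤-reflexive (∈words⇒length w∈)
    ∈wordsUpTo⇒length≤ {suc d} w∈ with ∈-++⁻ (wordsUpTo m d) w∈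
    ... | inj₁ w∈′ = m≤n⇒m≤1+n (∈wordsUpTo⇒length≤ w∈′)
    ... | inj₂ w∈′ = ≤-reflexive (∈words⇒length w∈′)

    ∈-wordsUpTo : ∀ {d} (w : Word m) → length w ≤ d → w ∈ wordsUpTo m d
    ∈-wordsUpTo {zero} [] _ = here refl
    ∈-wordsUpTo {suc d} w |w|≤ with length w ≤? d
    ... | yes |w|≤d = ∈-++⁺ˡ (∈-wordsUpTo w |w|≤d)
    ... | no |w|≰d = ∈-++⁺ʳ (wordsUpTo m d)
          (subst (λ k → w ∈ words m k) (≤-antisym |w|≤ (≰⇒> |w|≰d)) (∈-words w))

    childOf⇒≡∷ : {u w : Word m} → childOf u w ≡ true → ∃ λ a → w ≡ a ∷ u
    childOf⇒≡∷ {u} {a ∷ w} e = a , cong (a ∷_) (sym (eqW⇒≡ e))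

    childOf⇒length : {u w : Word m} → childOf u w ≡ true → length w ≡ suc (length u)
    childOf⇒length {u} {w} e with childOf⇒≡∷ {u} {w} e
    ... | _ , refl = refl

    childOf-irrefl : (u : Word m) → childOf u u ≡ false
    childOf-irrefl u with childOf u u in e
    ... | false = refl
    ... | true = ⊥-elim (1+n≢n (sym (childOf⇒length {u} {u} e)))

    childOf-asym : (u w : Word m) → childOf u w ≡ true → childOf w u ≡ false
    childOf-asym u w e with childOf w u in e′
    ... | false = refl
    ... | true = ⊥-elim (<-irrefl (trans (childOf⇒length {w} {u} e′) (cong suc (childOf⇒length {u} {w} e)))
                                  (m<n⇒m<1+n (n<1+n (length u))))

    treeDist-adjacent : (u w v : Word m) → (childOf u w ∨ childOf w u) ≡ true →
      treeDist u v ≤ suc (treeDist w v)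
    treeDist-adjacent u w v adj with ∨≡true⁻ {childOf u w} adj
    ... | inj₁ u→w with childOf⇒≡∷ {u} {w} u→w
    ...   | a , refl = ≤-suc-towards (does (a ∷ u ≼? v)) (treeDist u v)
      where
        ≤-suc-towards : (b : Bool) (n : ℕ) → n ≤ suc (towards b n)
        ≤-suc-towards true zero = z≤n
        ≤-suc-towards true (suc n) = ≤-refl
        ≤-suc-towards false n = m≤n⇒m≤1+n (n≤1+n n)
    treeDist-adjacent u w v adj | inj₂ w→u with childOf⇒≡∷ {w} {u} w→u
    ...   | a , refl = towards≤suc (does (a ∷ w ≼? v)) (treeDist w v)
      where
        towards≤suc : (b : Bool) (n : ℕ) → towards b n ≤ suc n
        towards≤suc true n = ≤-trans pred[n]≤n (n≤1+n n)
        towards≤suc false n = ≤-refl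

  -- The graph distance of F m d

  module Distance (m d : ℕ) where

    reachF : ℕ → Word m → Word m → Bool
    reachF = reach (F m d) eqW

    reach-sound : ∀ k (u v : Word m) → reachF k u v ≡ true → treeDist u v ≤ k
    reach-sound zero u v e rewrite eqW⇒≡ {u = u} {v} e = ≤-reflexive (treeDist-self v)
    reach-sound (suc k) u v e with ∨≡true⁻ {reachF k u v} e
    ... | inj₁ e′ = m≤n⇒m≤1+n (reach-sound k u v e′)
    ... | inj₂ e′ with any≡true⁻ _ (wordsUpTo m d) e′
    ...   | w , _ , q with ∧≡true⁻ {childOf u w ∨ childOf w u} q
    ...     | adj , r = ≤-trans (treeDist-adjacent u w v adj) (s≤s (reach-sound k w v r))

    closer-neighbour : ∀ k (u v : Word m) → length u ≤ d → length v ≤ d → treeDist u v ≡ suc k →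
      ∃ λ w → length w ≤ d × (childOf u w ∨ childOf w u) ≡ true × treeDist w v ≡ k
    closer-neighbour k u v |u|≤d |v|≤d e with u ≼? v
    ... | yes u≼v with u ≟ʷ v
    ...   | yes refl with trans (sym e) (treeDist-self u)
    ...     | ()
    closer-neighbour k u v |u|≤d |v|≤d e | yes u≼v | no u≢v with ≼∧≢⇒child≼ u≼v u≢v
    ...   | a , au≼v =
      a ∷ u , ≤-trans (≼⇒length≤ au≼v) |v|≤d , cong (_∨ childOf (a ∷ u) u) (eqW-refl u) ,
      trans (cong (λ b → towards b (treeDist u v)) (dec-true (a ∷ u ≼? v) au≼v)) (cong pred e)
    closer-neighbour k [] v |u|≤d |v|≤d e | no []⋠v = ⊥-elim ([]⋠v ([]≼ v))
    closer-neighbour k (a ∷ u) v |u|≤d |v|≤d e | no au⋠v =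
      u , ≤-trans (n≤1+n _) |u|≤d , trans (cong (childOf (a ∷ u) u ∨_) (eqW-refl u)) (∨-zeroʳ _) ,
      suc-injective (trans (sym (cong (λ b → towards b (treeDist u v)) (dec-false (a ∷ u ≼? v) au⋠v))) e)

    reach-complete : ∀ k (u v : Word m) → length u ≤ d → length v ≤ d → treeDist u v ≤ k → reachF k u v ≡ true
    reach-complete zero u v _ _ le rewrite treeDist≡0⇒≡ {u = u} {v = v} (n≤0⇒n≡0 le) = eqW-refl v
    reach-complete (suc k) u v |u|≤d |v|≤d le with treeDist u v ≤? k
    ... | yes le′ rewrite reach-complete k u v |u|≤d |v|≤d le′ = refl
    ... | no le′ with closer-neighbour k u v |u|≤d |v|≤d (≤-antisym le (≰⇒> le′))
    ...   | w , |w|≤d , adj , e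
      rewrite any≡true⁺ (λ w → (childOf u w ∨ childOf w u) ∧ reachF k w v) (∈-wordsUpTo w |w|≤d)
                (subst (λ b → b ∧ reachF k w v ≡ true) (sym adj) (reach-complete k w v |w|≤d |v|≤d (≤-reflexive e)))
      = ∨-zeroʳ (reachF k u v)

    distFrom≡treeDist : ∀ fuel k (u v : Word m) → length u ≤ d → length v ≤ d →
      k ≤ treeDist u v → treeDist u v < k + fuel → distFrom (F m d) eqW k fuel u v ≡ treeDist u v
    distFrom≡treeDist zero k u v _ _ k≤ <k = ⊥-elim (<⇒≱ <k (subst (_≤ treeDist u v) (sym (+-identityʳ k)) k≤))
    distFrom≡treeDist (suc fuel) k u v |u|≤d |v|≤d k≤ <k with reachF k u v in eq
    ... | true = ≤-antisym k≤ (reach-sound k u v eq)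
    ... | false with treeDist u v ≤? k
    ...   | yes ≤k with trans (sym eq) (reach-complete k u v |u|≤d |v|≤d ≤k)
    ...     | ()
    distFrom≡treeDist (suc fuel) k u v |u|≤d |v|≤d k≤ <k | false | no ≰k =
      distFrom≡treeDist fuel (suc k) u v |u|≤d |v|≤d (≰⇒> ≰k) (subst (treeDist u v <_) (+-suc k fuel) <k)

    dist≡treeDist : (u v : Word m) → length u ≤ d → length v ≤ d → treeDist u v < order (F m d) →
      dist (F m d) eqW u v ≡ treeDist u v
    dist≡treeDist u v |u|≤d |v|≤d lt = distFrom≡treeDist (order (F m d)) 0 u v |u|≤d |v|≤d z≤n lt

  -- Counting words level by level

  geomSum : ℕ → ℕ → ℕ
  geomSum m zero = 0
  geomSum m (suc j) = geomSum m j + m ^ j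

  geomSum-mono-≤ : ∀ m {i j} → i ≤ j → geomSum m i ≤ geomSum m j
  geomSum-mono-≤ m {j = zero} z≤n = ≤-refl
  geomSum-mono-≤ m {i} {suc j} i≤1+j with i ≤? j
  ... | yes i≤j = ≤-trans (geomSum-mono-≤ m i≤j) (m≤m+n (geomSum m j) (m ^ j))
  ... | no i≰j = ≤-reflexive (cong (geomSum m) (≤-antisym i≤1+j (≰⇒> i≰j)))

  geomSum≤^ : ∀ {m} → 2 ≤ m → ∀ j → geomSum m j ≤ m ^ j
  geomSum≤^ 2≤m zero = z≤n
  geomSum≤^ {m} 2≤m (suc j) = begin
      geomSum m j + m ^ j  ≤⟨ +-monoˡ-≤ (m ^ j) (geomSum≤^ 2≤m j) ⟩
      m ^ j + m ^ j        ≡⟨ cong (m ^ j +_) (sym (+-identityʳ (m ^ j))) ⟩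
      2 * m ^ j            ≤⟨ *-monoˡ-≤ (m ^ j) 2≤m ⟩
      m * m ^ j            ∎
    where open ≤-Reasoning

  double<geomSum : ∀ {m} → 2 ≤ m → ∀ e → e + e < geomSum m (suc e)
  double<geomSum 2≤m zero = z<s
  double<geomSum {m} 2≤m (suc e) = begin-strict
      suc e + suc e             ≡⟨ +-suc (suc e) e ⟩
      2 + (e + e)               <⟨ +-monoʳ-< 2 (double<geomSum 2≤m e) ⟩
      2 + geomSum m (suc e)     ≡⟨ +-comm 2 _ ⟩
      geomSum m (suc e) + 2     ≤⟨ +-monoʳ-≤ (geomSum m (suc e)) (*-mono-≤ 2≤m (m^n>0 m e)) ⟩
      geomSum m (suc e) + m * m ^ e ∎
    where
      open ≤-Reasoning
      instance
        m≢0 : NonZero m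
        m≢0 = >-nonZero (<-trans z<s 2≤m)

  module Levels (m : ℕ) where

    sumBy-words-suc : (f : Word m → ℕ) (j : ℕ) →
      sumBy f (words m (suc j)) ≡ sumBy (λ x → sumBy (λ a → f (a ∷ x)) (allFin m)) (words m j)
    sumBy-words-suc f j = trans (sumBy-concatMap f (λ x → map (_∷ x) (allFin m)) (words m j))
                                (sumBy-cong (words m j) (λ x _ → sumBy-map f (_∷ x) (allFin m)))

    sumBy-allFin-const : (c : ℕ) → sumBy (λ _ → c) (allFin m) ≡ m * c
    sumBy-allFin-const c = trans (sumBy-const c (allFin m)) (cong (_* c) (List.length-tabulate {n = m} id))

    sumBy-words-const : (c j : ℕ) → sumBy (λ _ → c) (words m j) ≡ m ^ j * c
    sumBy-words-const c zero = refl
    sumBy-words-const c (suc j) = begin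
        sumBy (λ _ → c) (words m (suc j))  ≡⟨ sumBy-words-suc (λ _ → c) j ⟩
        sumBy (λ _ → sumBy (λ _ → c) (allFin m)) (words m j)
          ≡⟨ sumBy-cong (words m j) (λ _ _ → sumBy-allFin-const c) ⟩
        sumBy (λ _ → m * c) (words m j)    ≡⟨ sumBy-words-const (m * c) j ⟩
        m ^ j * (m * c)                    ≡⟨ reorder (m ^ j) m c ⟩
        m * m ^ j * c                      ∎
      where
        open ≡-Reasoning
        reorder : ∀ a b c → a * (b * c) ≡ b * a * c
        reorder = solve-∀

    length-wordsUpTo : (e : ℕ) → length (wordsUpTo m e) ≡ geomSum m (suc e)
    length-wordsUpTo e = trans (sym (trans (sumBy-const 1 (wordsUpTo m e)) (*-identityʳ _))) (ones e)
      where
        ones : (e : ℕ) → sumBy (λ _ → 1) (wordsUpTo m e) ≡ geomSum m (suc e)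
        ones zero = refl
        ones (suc e) = trans (sumBy-++ (λ _ → 1) (wordsUpTo m e) (words m (suc e)))
          (cong₂ _+_ (ones e) (trans (sumBy-words-const 1 (suc e)) (*-identityʳ _)))

    occurrences-words-self : (y : Word m) → sumBy (boolToℕ ∘ eqW y) (words m (length y)) ≡ 1
    occurrences-words-self [] = cong (λ b → boolToℕ b + 0) (eqW-refl {m} [])
    occurrences-words-self (a ∷ y) =
      trans (sumBy-words-suc (boolToℕ ∘ eqW (a ∷ y)) (length y))
            (trans (sumBy-cong (words m (length y)) (λ x _ → inner x)) (occurrences-words-self y))
      where
        inner : (x : Word m) → sumBy (λ b → boolToℕ (eqW (a ∷ y) (b ∷ x))) (allFin m) ≡ boolToℕ (eqW y x)
        inner x = byCases (y ≟ʷ x)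
          where
            byCases : Dec (y ≡ x) → sumBy (λ b → boolToℕ (eqW (a ∷ y) (b ∷ x))) (allFin m) ≡ boolToℕ (eqW y x)
            byCases (yes refl) =
              trans (sumBy-allFin-single m (λ b → eqW (a ∷ y) (b ∷ y)) a (eqW-refl (a ∷ y))
                                         (λ b e → sym (List.∷-injectiveˡ (eqW⇒≡ e))))
                    (cong boolToℕ (sym (eqW-refl y)))
            byCases (no y≢x) =
              trans (sumBy-zero _ (allFin m) (λ b _ → cong boolToℕ (eqW-≢ (y≢x ∘ List.∷-injectiveʳ))))
                    (cong boolToℕ (sym (eqW-≢ y≢x)))

    occurrences-words-other : (y : Word m) (j : ℕ) → length y ≢ j → sumBy (boolToℕ ∘ eqW y) (words m j) ≡ 0
    occurrences-words-other y j |y|≢j =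
      sumBy-zero _ (words m j) (λ x x∈ → cong boolToℕ (eqW-≢ (λ y≡x → |y|≢j (trans (cong length y≡x) (∈words⇒length x∈)))))

    occurrences-wordsUpTo-absent : (y : Word m) (e : ℕ) → e < length y → sumBy (boolToℕ ∘ eqW y) (wordsUpTo m e) ≡ 0
    occurrences-wordsUpTo-absent y zero lt = trans (occurrences-words-other y 0 (>⇒≢ lt)) refl
    occurrences-wordsUpTo-absent y (suc e) lt
      rewrite sumBy-++ (boolToℕ ∘ eqW y) (wordsUpTo m e) (words m (suc e))
            | occurrences-wordsUpTo-absent y e (<⇒≤ lt) | occurrences-words-other y (suc e) (>⇒≢ lt) = refl

    occurrences-wordsUpTo : (y : Word m) (e : ℕ) → length y ≤ e → sumBy (boolToℕ ∘ eqW y) (wordsUpTo m e) ≡ 1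
    occurrences-wordsUpTo y zero le with n≤0⇒n≡0 le
    ... | |y|≡0 = subst (λ j → sumBy (boolToℕ ∘ eqW y) (words m j) ≡ 1) |y|≡0 (occurrences-words-self y)
    occurrences-wordsUpTo y (suc e) le rewrite sumBy-++ (boolToℕ ∘ eqW y) (wordsUpTo m e) (words m (suc e))
      with length y ≟ suc e
    ... | yes |y|≡ rewrite occurrences-wordsUpTo-absent y e (subst (e <_) (sym |y|≡) (n<1+n e)) =
      subst (λ j → sumBy (boolToℕ ∘ eqW y) (words m j) ≡ 1) |y|≡ (occurrences-words-self y)
    ... | no |y|≢ rewrite occurrences-wordsUpTo y e (≤-pred (≤∧≢⇒< le |y|≢)) | occurrences-words-other y (suc e) |y|≢ = refl

    descendants-words-shallow : (y : Word m) (j : ℕ) → j < length y → sumBy (boolToℕ ∘ does ∘ (y ≼?_)) (words m j) ≡ 0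
    descendants-words-shallow y j lt = sumBy-zero _ (words m j) λ x x∈ →
      cong boolToℕ (dec-false (y ≼? x) (λ y≼x → <⇒≱ lt (subst (length y ≤_) (∈words⇒length x∈) (≼⇒length≤ y≼x))))

    descendants-words : (i : ℕ) (y : Word m) → sumBy (boolToℕ ∘ does ∘ (y ≼?_)) (words m (length y + i)) ≡ m ^ i
    descendants-words zero y rewrite +-identityʳ (length y) =
      trans (sumBy-cong (words m (length y)) (λ x x∈ → cong boolToℕ (≼?-sameLength y x (∈words⇒length x∈))))
            (occurrences-words-self y)
    descendants-words (suc i) y rewrite +-suc (length y) i = begin
        sumBy (boolToℕ ∘ does ∘ (y ≼?_)) (words m (suc (length y + i)))
          ≡⟨ sumBy-words-suc (boolToℕ ∘ does ∘ (y ≼?_)) (length y + i) ⟩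
        sumBy (λ x → sumBy (λ b → boolToℕ (does (y ≼? b ∷ x))) (allFin m)) (words m (length y + i))
          ≡⟨ sumBy-cong (words m (length y + i)) (λ x x∈ → inner x (∈words⇒length x∈)) ⟩
        sumBy (λ x → m * boolToℕ (does (y ≼? x))) (words m (length y + i))
          ≡⟨ sumBy-* m _ (words m (length y + i)) ⟩
        m * sumBy (boolToℕ ∘ does ∘ (y ≼?_)) (words m (length y + i))
          ≡⟨ cong (m *_) (descendants-words i y) ⟩
        m * m ^ i ∎
      where
        open ≡-Reasoning
        inner : (x : Word m) → length x ≡ length y + i →
          sumBy (λ b → boolToℕ (does (y ≼? b ∷ x))) (allFin m) ≡ m * boolToℕ (does (y ≼? x))
        inner x |x| = trans (sumBy-cong (allFin m) (λ b _ → cong boolToℕ (below b (y ≼? x))))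
                            (sumBy-allFin-const _)
          where
            below : ∀ b (y≼?x : Dec (y ≼ x)) → does (y ≼? b ∷ x) ≡ does y≼?x
            below b (yes y≼x) = dec-true (y ≼? b ∷ x) (≼-∷ y≼x)
            below b (no y⋠x) = dec-false (y ≼? b ∷ x) λ y≼bx →
              y⋠x (≼-∷⁻ y≼bx (subst (length y ≤_) (sym |x|) (m≤m+n (length y) i)))

    subtreeSize-wordsUpTo : (y : Word m) (e : ℕ) →
      sumBy (boolToℕ ∘ does ∘ (y ≼?_)) (wordsUpTo m e) ≡ geomSum m (suc e ∸ length y)
    subtreeSize-wordsUpTo [] zero = refl
    subtreeSize-wordsUpTo (a ∷ y) zero =
      trans (descendants-words-shallow (a ∷ y) 0 (s≤s z≤n)) (cong (geomSum m) (sym (0∸n≡0 (length y))))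
    subtreeSize-wordsUpTo y (suc e) =
      trans (sumBy-++ _ (wordsUpTo m e) (words m (suc e)))
            (trans (cong (_+ sumBy (boolToℕ ∘ does ∘ (y ≼?_)) (words m (suc e))) (subtreeSize-wordsUpTo y e)) (lastLevel (length y ≤? suc e)))
      where
        lastLevel : Dec (length y ≤ suc e) →
          geomSum m (suc e ∸ length y) + sumBy (boolToℕ ∘ does ∘ (y ≼?_)) (words m (suc e))
            ≡ geomSum m (suc (suc e) ∸ length y)
        lastLevel (yes le) rewrite +-∸-assoc 1 le = cong (geomSum m (suc e ∸ length y) +_)
          (trans (cong (λ j → sumBy (boolToℕ ∘ does ∘ (y ≼?_)) (words m j)) (sym (m+[n∸m]≡n le)))
                 (descendants-words (suc e ∸ length y) y))
        lastLevel (no nle) rewrite m≤n⇒m∸n≡0 (<⇒≤ (≰⇒> nle)) | m≤n⇒m∸n≡0 (≰⇒> nle) =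
          descendants-words-shallow y (suc e) (≰⇒> nle)

    children-wordsUpTo : (e : ℕ) (w : Word m) → length w ≤ e →
      countB (childOf w) (wordsUpTo m e) ≡ (if length w <ᵇ e then m else 0)
    children-wordsUpTo zero w _ = refl
    children-wordsUpTo (suc e) w le = begin
        countB (childOf w) (wordsUpTo m (suc e))
          ≡⟨ countB≡sumBy (childOf w) (wordsUpTo m (suc e)) ⟩
        sumBy (boolToℕ ∘ childOf w) (wordsUpTo m (suc e))
          ≡⟨ children-upTo e ⟩
        m * sumBy (boolToℕ ∘ eqW w) (wordsUpTo m e)
          ≡⟨ lastLevel (length w ≤? e) ⟩
        (if length w <ᵇ suc e then m else 0) ∎
      where
        open ≡-Reasoning
        children-level : (j : ℕ) → sumBy (boolToℕ ∘ childOf w) (words m (suc j)) ≡ m * sumBy (boolToℕ ∘ eqW w) (words m j)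
        children-level j = trans (sumBy-words-suc (boolToℕ ∘ childOf w) j)
          (trans (sumBy-cong (words m j) (λ x _ → sumBy-allFin-const (boolToℕ (eqW w x))))
                 (sumBy-* m (boolToℕ ∘ eqW w) (words m j)))
        children-upTo : (e : ℕ) → sumBy (boolToℕ ∘ childOf w) (wordsUpTo m (suc e)) ≡ m * sumBy (boolToℕ ∘ eqW w) (wordsUpTo m e)
        children-upTo zero = children-level 0
        children-upTo (suc e) = trans (sumBy-++ (boolToℕ ∘ childOf w) (wordsUpTo m (suc e)) (words m (suc (suc e))))
          (trans (cong₂ _+_ (children-upTo e) (children-level (suc e)))
          (trans (sym (*-distribˡ-+ m _ _)) (cong (m *_) (sym (sumBy-++ (boolToℕ ∘ eqW w) (wordsUpTo m e) (words m (suc e)))))))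
        lastLevel : Dec (length w ≤ e) → m * sumBy (boolToℕ ∘ eqW w) (wordsUpTo m e) ≡ (if length w <ᵇ suc e then m else 0)
        lastLevel (yes le′) rewrite occurrences-wordsUpTo w e le′ | <⇒<ᵇ≡true (s≤s le′) = *-identityʳ m
        lastLevel (no nle) rewrite occurrences-wordsUpTo-absent w e (≰⇒> nle) | ≤-antisym le (≰⇒> nle)
                                 | ≥⇒<ᵇ≡false {suc e} {suc e} ≤-refl = *-zeroʳ m

  order-F : ∀ m d → order (F m d) ≡ geomSum m (suc d)
  order-F m d = Levels.length-wordsUpTo m d

  -- Degrees, edges and the irregularity

  module Tree (m d : ℕ) where
    open Levels m

    vertices : List (Word m)
    vertices = wordsUpTo m d

    parent∈vertices : {a : Fin m} {t : Word m} → a ∷ t ∈ vertices → t ∈ vertices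
    parent∈vertices {t = t} at∈V = ∈-wordsUpTo t (≤-trans (n≤1+n _) (∈wordsUpTo⇒length≤ {d = d} at∈V))

    toParent : (Word m × Word m → ℕ) → Word m → ℕ
    toParent h [] = 0
    toParent h (a ∷ t) = h (t , a ∷ t)

    -- Every edge joins a non-root vertex to its parent.
    sum-edges : (h : Word m × Word m → ℕ) → (∀ u v → h (u , v) ≡ h (v , u)) →
      sum (map h (edges (F m d))) ≡ sumBy (toParent h) vertices
    sum-edges h h-sym =
      trans (sum-keep-pairs vertices childOf _ h (λ _ _ → refl) h-sym childOf-asym childOf-irrefl)
            (trans (sumBy-swap (λ x y → if childOf x y then h (x , y) else 0) vertices vertices) (sumBy-cong vertices column))
      where
        column : ∀ y → y ∈ vertices → sumBy (λ x → if childOf x y then h (x , y) else 0) vertices ≡ toParent h y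
        column [] _ = sumBy-zero _ vertices (λ _ _ → refl)
        column (a ∷ t) at∈V =
          trans (sumBy-cong vertices (λ x _ → pick x (x ≟ʷ t)))
                (trans (sumBy-* e (boolToℕ ∘ eqW t) vertices)
                       (trans (cong (e *_) (occurrences-wordsUpTo t d (∈wordsUpTo⇒length≤ (parent∈vertices at∈V))))
                              (*-identityʳ e)))
          where
            e : ℕ
            e = h (t , a ∷ t)
            pick : ∀ x → Dec (x ≡ t) → (if eqW x t then h (x , a ∷ t) else 0) ≡ e * boolToℕ (eqW t x)
            pick x (yes refl) rewrite eqW-refl x = sym (*-identityʳ e)
            pick x (no x≢t) rewrite eqW-≢ x≢t | eqW-≢ (x≢t ∘ sym) = sym (*-zeroʳ e)

    levelSum : (ℕ → ℕ) → ℕ → ℕ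
    levelSum Φ zero = Φ 0
    levelSum Φ (suc e) = levelSum Φ e + m ^ suc e * Φ (suc e)

    sumBy-depth : (Φ : ℕ → ℕ) (e : ℕ) → sumBy (Φ ∘ length) (wordsUpTo m e) ≡ levelSum Φ e
    sumBy-depth Φ zero = +-identityʳ (Φ 0)
    sumBy-depth Φ (suc e) = trans (sumBy-++ (Φ ∘ length) (wordsUpTo m e) (words m (suc e)))
      (cong₂ _+_ (sumBy-depth Φ e)
                 (trans (sumBy-cong (words m (suc e)) (λ y y∈ → cong Φ (∈words⇒length y∈)))
                        (sumBy-words-const (Φ (suc e)) (suc e))))

    hasParent : ℕ → ℕ
    hasParent zero = 0
    hasParent (suc _) = 1

    degreeAt : ℕ → ℕ
    degreeAt k = (if k <ᵇ d then m else 0) + hasParent k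

    parents : (w : Word m) → w ∈ vertices → countB (λ x → childOf x w) vertices ≡ hasParent (length w)
    parents [] _ = trans (countB≡sumBy _ vertices) (sumBy-zero _ vertices (λ _ _ → refl))
    parents (a ∷ t) at∈V =
      trans (countB≡sumBy _ vertices)
            (trans (sumBy-cong vertices (λ x _ → cong boolToℕ (eqW-sym x t)))
                   (occurrences-wordsUpTo t d (∈wordsUpTo⇒length≤ (parent∈vertices at∈V))))

    degree≡degreeAt : (w : Word m) → w ∈ vertices → degree (F m d) w ≡ degreeAt (length w)
    degree≡degreeAt w w∈V =
      trans (countB-∨-disjoint (childOf w) (λ x → childOf x w) vertices (childOf-asym w))
            (cong₂ _+_ (children-wordsUpTo d w (∈wordsUpTo⇒length≤ w∈V)) (parents w w∈V))

    degreeAt-root : 0 < d → degreeAt 0 ≡ m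
    degreeAt-root 0<d = trans (cong (λ b → (if b then m else 0) + 0) (<⇒<ᵇ≡true 0<d)) (+-identityʳ m)

    degreeAt-inner : ∀ {k} → 0 < k → k < d → degreeAt k ≡ suc m
    degreeAt-inner {suc k} _ k<d = trans (cong (λ b → (if b then m else 0) + 1) (<⇒<ᵇ≡true k<d)) (+-comm m 1)

    degreeAt-leaf : 0 < d → degreeAt d ≡ 1
    degreeAt-leaf 0<d = cong₂ (λ b p → (if b then m else 0) + p) (≥⇒<ᵇ≡false {d} {d} ≤-refl) (hasParent-pos 0<d)
      where
        hasParent-pos : ∀ {k} → 0 < k → hasParent k ≡ 1
        hasParent-pos z<s = refl

    irrAt : ℕ → ℕ
    irrAt zero = 0
    irrAt (suc k) = ∣ degreeAt k - degreeAt (suc k) ∣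

    irr≡levelSum : irr (F m d) ≡ levelSum irrAt d
    irr≡levelSum =
      trans (sum-edges _ (λ u v → ∣-∣-comm (degree (F m d) u) (degree (F m d) v)))
            (trans (sumBy-cong vertices edgeTerm) (sumBy-depth irrAt d))
      where
        edgeTerm : ∀ y → y ∈ vertices → toParent (λ { (u , v) → ∣ degree (F m d) u - degree (F m d) v ∣ }) y ≡ irrAt (length y)
        edgeTerm [] _ = refl
        edgeTerm (a ∷ t) at∈V = cong₂ ∣_-_∣ (degree≡degreeAt t (parent∈vertices at∈V)) (degree≡degreeAt (a ∷ t) at∈V)

    -- Only the m edges at the root and the edges to the leaves are irregular.
    levelSum-irrAt-inner : ∀ j → 0 < j → j < d → levelSum irrAt j ≡ m
    levelSum-irrAt-inner 1 _ 1<d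
      rewrite degreeAt-root (<-trans z<s 1<d) | degreeAt-inner z<s 1<d =
      trans (cong (m * 1 *_) ∣m-1+m∣≡1) (*-identityʳ-twice m)
      where
        ∣m-1+m∣≡1 : ∣ m - suc m ∣ ≡ 1
        ∣m-1+m∣≡1 = trans (∣-∣-comm m (suc m)) (trans (m≤n⇒∣n-m∣≡n∸m (n≤1+n m)) (m+n∸n≡m 1 m))
        *-identityʳ-twice : ∀ m → m * 1 * 1 ≡ m
        *-identityʳ-twice = solve-∀
    levelSum-irrAt-inner (suc (suc j)) _ j+2<d
      rewrite levelSum-irrAt-inner (suc j) z<s (<-trans (n<1+n _) j+2<d)
            | degreeAt-inner {suc j} z<s (<-trans (n<1+n _) j+2<d) | degreeAt-inner {suc (suc j)} z<s j+2<d
            | ∣n-n∣≡0 (suc m) =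
      trans (cong (m +_) (*-zeroʳ (m ^ suc (suc j)))) (+-identityʳ m)

  irr-F : ∀ m d → 2 ≤ d → irr (F m d) ≡ m + m ^ (d + 1)
  irr-F m (suc (suc k)) (s≤s (s≤s z≤n)) = begin
      irr (F m (2 + k))
        ≡⟨ irr≡levelSum ⟩
      levelSum irrAt (1 + k) + m ^ (2 + k) * ∣ degreeAt (1 + k) - degreeAt (2 + k) ∣
        ≡⟨ cong₂ (λ s t → s + m ^ (2 + k) * ∣ t - degreeAt (2 + k) ∣)
                 (levelSum-irrAt-inner (1 + k) z<s ≤-refl) (degreeAt-inner z<s ≤-refl) ⟩
      m + m ^ (2 + k) * ∣ suc m - degreeAt (2 + k) ∣
        ≡⟨ cong (λ t → m + m ^ (2 + k) * ∣ suc m - t ∣) (degreeAt-leaf z<s) ⟩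
      m + m ^ (2 + k) * ∣ m - 0 ∣
        ≡⟨ cong (λ t → m + m ^ (2 + k) * t) (∣-∣-identityʳ m) ⟩
      m + m ^ (2 + k) * m
        ≡⟨ cong (m +_) (trans (cong (m ^ (2 + k) *_) (sym (*-identityʳ m))) (sym (^-distribˡ-+-* m (2 + k) 1))) ⟩
      m + m ^ (2 + k + 1) ∎
    where
      open ≡-Reasoning
      open Tree m (2 + k)

  -- The two sides of an edge and the Mostar index

  module Mostar (m d : ℕ) (2≤m : 2 ≤ m) where
    open Levels m
    open Distance m d
    open Tree m d

    N : ℕ
    N = geomSum m (suc d)

    subtreeSize : ℕ → ℕ
    subtreeSize k = geomSum m (suc d ∸ k)

    dist≡treeDist-vertices : ∀ {u v} → u ∈ vertices → v ∈ vertices → dist (F m d) eqW u v ≡ treeDist u v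
    dist≡treeDist-vertices {u} {v} u∈V v∈V = dist≡treeDist u v |u|≤d |v|≤d
      (subst (treeDist u v <_) (sym (length-wordsUpTo d))
             (≤-<-trans (≤-trans (treeDist≤ u v) (+-mono-≤ |u|≤d |v|≤d)) (double<geomSum 2≤m d)))
      where
        |u|≤d : length u ≤ d
        |u|≤d = ∈wordsUpTo⇒length≤ u∈V
        |v|≤d : length v ≤ d
        |v|≤d = ∈wordsUpTo⇒length≤ v∈V

    dist-child<ᵇdist-parent : (a : Fin m) (t w : Word m) → w ∈ vertices → a ∷ t ∈ vertices →
      (dist (F m d) eqW w (a ∷ t) <ᵇ dist (F m d) eqW w t) ≡ does (a ∷ t ≼? w)
    dist-child<ᵇdist-parent a t w w∈V at∈V
      rewrite dist≡treeDist-vertices w∈V at∈V | dist≡treeDist-vertices w∈V (parent∈vertices at∈V) | treeDist-child w a t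
      = compare (a ∷ t ≼? w)
      where
        compare : (at≼?w : Dec (a ∷ t ≼ w)) → (towards (does at≼?w) (treeDist w t) <ᵇ treeDist w t) ≡ does at≼?w
        compare (yes at≼w) = towards-<ᵇ true (treeDist w t)
          (λ _ e → <-irrefl (cong length (sym (treeDist≡0⇒≡ {u = w} {v = t} e))) (≼⇒length≤ at≼w))
        compare (no _) = towards-<ᵇ false (treeDist w t) (λ ())

    dist-parent<ᵇdist-child : (a : Fin m) (t w : Word m) → w ∈ vertices → a ∷ t ∈ vertices →
      (dist (F m d) eqW w t <ᵇ dist (F m d) eqW w (a ∷ t)) ≡ not (does (a ∷ t ≼? w))
    dist-parent<ᵇdist-child a t w w∈V at∈V
      rewrite dist≡treeDist-vertices w∈V at∈V | dist≡treeDist-vertices w∈V (parent∈vertices at∈V) | treeDist-child w a t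
      = <ᵇ-towards (does (a ∷ t ≼? w)) (treeDist w t)

    count-subtree : (y : Word m) → countB (does ∘ (y ≼?_)) vertices ≡ subtreeSize (length y)
    count-subtree y = trans (countB≡sumBy _ vertices) (subtreeSize-wordsUpTo y d)

    nG-child : (a : Fin m) (t : Word m) → a ∷ t ∈ vertices → nG (F m d) eqW (a ∷ t) t ≡ subtreeSize (suc (length t))
    nG-child a t at∈V =
      trans (countB≡sumBy _ vertices)
            (trans (sumBy-cong vertices (λ w w∈V → cong boolToℕ (dist-child<ᵇdist-parent a t w w∈V at∈V)))
                   (trans (sym (countB≡sumBy _ vertices)) (count-subtree (a ∷ t))))

    nG-parent : (a : Fin m) (t : Word m) → a ∷ t ∈ vertices → nG (F m d) eqW t (a ∷ t) ≡ N ∸ subtreeSize (suc (length t))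
    nG-parent a t at∈V = begin
        nG (F m d) eqW t (a ∷ t)
          ≡⟨ trans (countB≡sumBy _ vertices)
                   (trans (sumBy-cong vertices (λ w w∈V → cong boolToℕ (dist-parent<ᵇdist-child a t w w∈V at∈V)))
                          (sym (countB≡sumBy _ vertices))) ⟩
        countB (not ∘ inSubtree) vertices
          ≡⟨ sym (m+n∸n≡m _ (countB inSubtree vertices)) ⟩
        countB (not ∘ inSubtree) vertices + countB inSubtree vertices ∸ countB inSubtree vertices
          ≡⟨ cong₂ _∸_ (trans (countB-not+countB inSubtree vertices) (length-wordsUpTo d)) (count-subtree (a ∷ t)) ⟩
        N ∸ subtreeSize (suc (length t)) ∎
      where
        open ≡-Reasoning
        inSubtree : Word m → Bool
        inSubtree = does ∘ (a ∷ t ≼?_)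

    moAt : ℕ → ℕ
    moAt zero = 0
    moAt (suc k) = ∣ (N ∸ subtreeSize (suc k)) - subtreeSize (suc k) ∣

    Mo≡levelSum : MoF m d ≡ levelSum moAt d
    Mo≡levelSum =
      trans (sum-edges _ (λ u v → ∣-∣-comm (nG (F m d) eqW u v) (nG (F m d) eqW v u)))
            (trans (sumBy-cong vertices edgeTerm) (sumBy-depth moAt d))
      where
        edgeTerm : ∀ y → y ∈ vertices →
          toParent (λ { (u , v) → ∣ nG (F m d) eqW u v - nG (F m d) eqW v u ∣ }) y ≡ moAt (length y)
        edgeTerm [] _ = refl
        edgeTerm (a ∷ t) at∈V = cong₂ ∣_-_∣ (nG-parent a t at∈V) (nG-child a t at∈V)

    subtreeSize-bound : ∀ k → subtreeSize (suc k) + subtreeSize (suc k) ≤ N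
    subtreeSize-bound k = +-mono-≤ (geomSum-mono-≤ m (m∸n≤m d k))
                                   (≤-trans (geomSum-mono-≤ m (m∸n≤m d k)) (geomSum≤^ 2≤m d))

    moAt-suc : ∀ k → moAt (suc k) + (subtreeSize (suc k) + subtreeSize (suc k)) ≡ N
    moAt-suc k = begin
        ∣ (N ∸ S) - S ∣ + (S + S)  ≡⟨ cong (_+ (S + S)) (m≤n⇒∣n-m∣≡n∸m S≤N∸S) ⟩
        N ∸ S ∸ S + (S + S)        ≡⟨ sym (+-assoc (N ∸ S ∸ S) S S) ⟩
        N ∸ S ∸ S + S + S          ≡⟨ cong (_+ S) (m∸n+n≡m S≤N∸S) ⟩
        N ∸ S + S                  ≡⟨ m∸n+n≡m (m+n≤o⇒m≤o S (subtreeSize-bound k)) ⟩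
        N                          ∎
      where
        open ≡-Reasoning
        S : ℕ
        S = subtreeSize (suc k)
        S≤N∸S : S ≤ N ∸ S
        S≤N∸S = m+n≤o⇒m≤o∸n S (subtreeSize-bound k)

module MostarIdentity where

  open FullTree using (geomSum; order-F; module Mostar; module Tree)
  open import Data.Nat as ℕ using (ℕ; zero; suc; _^_; _∸_; _≤_)
  import Data.Nat.Properties as ℕₚ
  open import Data.Integer using (ℤ; +_; _+_; _-_; _*_)
  import Data.Integer.Properties as ℤₚ
  open import Data.Integer.Tactic.RingSolver using (solve-∀)
  open import Relation.Binary.PropositionalEquality

  geomSum-closed : ∀ m j → (+ m - + 1) * + geomSum m j ≡ + (m ^ j) - + 1
  geomSum-closed m zero = ℤₚ.*-zeroʳ (+ m - + 1)
  geomSum-closed m (suc j) = begin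
      a * + (geomSum m j ℕ.+ m ^ j)              ≡⟨ cong (a *_) (ℤₚ.pos-+ (geomSum m j) (m ^ j)) ⟩
      a * (+ geomSum m j + + (m ^ j))            ≡⟨ ℤₚ.*-distribˡ-+ a (+ geomSum m j) (+ (m ^ j)) ⟩
      a * + geomSum m j + a * + (m ^ j)          ≡⟨ cong (_+ a * + (m ^ j)) (geomSum-closed m j) ⟩
      + (m ^ j) - + 1 + (+ m - + 1) * + (m ^ j)  ≡⟨ telescope (+ m) (+ (m ^ j)) ⟩
      + m * + (m ^ j) - + 1                      ≡⟨ cong (_- + 1) (sym (ℤₚ.pos-* m (m ^ j))) ⟩
      + (m ℕ.* m ^ j) - + 1                      ∎
    where
      open ≡-Reasoning
      a : ℤ
      a = + m - + 1
      telescope : ∀ x y → y - + 1 + (x - + 1) * y ≡ x * y - + 1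
      telescope = solve-∀

  -- (m - 1) Σ_{k=1}^{j} m^k (N - 2 S_k) in closed form, where Q = 1 + m + ⋯ + m^j,
  -- M = m^(d+1) and S_k = 1 + m + ⋯ + m^(d-k) is the size of a subtree rooted at depth k.
  partialMo : (a N Q M j : ℤ) → ℤ
  partialMo a N Q M j = a * N * (Q - + 1) - + 2 * j * M + + 2 * (Q - + 1)

  partialMo-step : ∀ a N Q M j x S y L → a * L ≡ partialMo a N Q M j → a * S ≡ y - + 1 → x * y ≡ M →
    a * (L + x * (N - + 2 * S)) ≡ partialMo a N (Q + x) M (+ 1 + j)
  partialMo-step a N Q M j x S y L hL hS hM = begin
      a * (L + x * (N - + 2 * S))                            ≡⟨ expand a N x S L ⟩
      a * L + a * x * N - + 2 * x * (a * S)                  ≡⟨ cong₂ (λ u v → u + a * x * N - + 2 * x * v) hL hS ⟩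
      partialMo a N Q M j + a * x * N - + 2 * x * (y - + 1)  ≡⟨ collect (partialMo a N Q M j) a N x y ⟩
      partialMo a N Q M j + a * x * N - + 2 * (x * y) + + 2 * x
        ≡⟨ cong (λ v → partialMo a N Q M j + a * x * N - + 2 * v + + 2 * x) hM ⟩
      partialMo a N Q M j + a * x * N - + 2 * M + + 2 * x     ≡⟨ regroup a N Q M j x ⟩
      partialMo a N (Q + x) M (+ 1 + j)                        ∎
    where
      open ≡-Reasoning
      expand : ∀ a N x S L → a * (L + x * (N - + 2 * S)) ≡ a * L + a * x * N - + 2 * x * (a * S)
      expand = solve-∀
      collect : ∀ R a N x y → R + a * x * N - + 2 * x * (y - + 1) ≡ R + a * x * N - + 2 * (x * y) + + 2 * x
      collect = solve-∀
      regroup : ∀ a N Q M j x →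
        (a * N * (Q - + 1) - + 2 * j * M + + 2 * (Q - + 1)) + a * x * N - + 2 * M + + 2 * x
          ≡ a * N * ((Q + x) - + 1) - + 2 * (+ 1 + j) * M + + 2 * ((Q + x) - + 1)
      regroup = solve-∀

  module _ (m d : ℕ) (2≤m : 2 ≤ m) where
    open Mostar m d 2≤m
    open Tree m d

    a M : ℤ
    a = + m - + 1
    M = + (m ^ suc d)

    moAt-ℤ : ∀ k → + moAt (suc k) ≡ + N - + 2 * + subtreeSize (suc k)
    moAt-ℤ k = trans (isolate (+ moAt (suc k)) (+ S))
                     (cong (_- + 2 * + S) (trans (sym (trans (ℤₚ.pos-+ (moAt (suc k)) (S ℕ.+ S))
                                                             (cong (_+_ (+ moAt (suc k))) (ℤₚ.pos-+ S S))))
                                                 (cong +_ (moAt-suc k))))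
      where
        S : ℕ
        S = subtreeSize (suc k)
        isolate : ∀ x s → x ≡ x + (s + s) - + 2 * s
        isolate = solve-∀

    levelSum-moAt : ∀ j → j ≤ d → a * + levelSum moAt j ≡ partialMo a (+ N) (+ geomSum m (suc j)) M (+ j)
    levelSum-moAt zero _ = trans (ℤₚ.*-zeroʳ a) (noLevels a (+ N) M)
      where
        noLevels : ∀ a N M → + 0 ≡ a * N * (+ 1 - + 1) - + 2 * + 0 * M + + 2 * (+ 1 - + 1)
        noLevels = solve-∀
    levelSum-moAt (suc i) i<d = begin
        a * + (levelSum moAt i ℕ.+ m ^ suc i ℕ.* moAt (suc i))
          ≡⟨ cong (a *_) (trans (ℤₚ.pos-+ (levelSum moAt i) _)
                                (cong (_+_ (+ levelSum moAt i)) (trans (ℤₚ.pos-* (m ^ suc i) _) (cong (+ (m ^ suc i) *_) (moAt-ℤ i))))) ⟩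
        a * (+ levelSum moAt i + + (m ^ suc i) * (+ N - + 2 * + subtreeSize (suc i)))
          ≡⟨ partialMo-step a (+ N) (+ geomSum m (suc i)) M (+ i) (+ (m ^ suc i)) (+ subtreeSize (suc i)) (+ (m ^ (d ∸ i)))
                            (+ levelSum moAt i) (levelSum-moAt i (ℕₚ.<⇒≤ i<d)) (geomSum-closed m (d ∸ i)) levels ⟩
        partialMo a (+ N) (+ geomSum m (suc i) + + (m ^ suc i)) M (+ 1 + + i)
          ≡⟨ cong₂ (λ Q j → partialMo a (+ N) Q M j) (sym (ℤₚ.pos-+ (geomSum m (suc i)) (m ^ suc i))) (sym (ℤₚ.pos-+ 1 i)) ⟩
        partialMo a (+ N) (+ geomSum m (suc (suc i))) M (+ suc i) ∎
      where
        open ≡-Reasoning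
        levels : + (m ^ suc i) * + (m ^ (d ∸ i)) ≡ M
        levels = trans (sym (ℤₚ.pos-* (m ^ suc i) (m ^ (d ∸ i))))
                       (cong +_ (trans (sym (ℕₚ.^-distribˡ-+-* m (suc i) (d ∸ i)))
                                       (cong (λ e → m ^ suc e) (ℕₚ.m+[n∸m]≡n (ℕₚ.<⇒≤ i<d)))))

  order-F-closed : ∀ m d → (+ m - + 1) * + order (F m d) ≡ + (m ^ (d ℕ.+ 1)) - + 1
  order-F-closed m d rewrite order-F m d =
    trans (geomSum-closed m (suc d)) (cong (λ e → + (m ^ e) - + 1) (ℕₚ.+-comm 1 d))

  Mo-F-closed : ∀ m d → 2 ≤ m →
    let N = + order (F m d) in
    (+ m - + 1) * + MoF m d ≡ ((+ m - + 1) * ((N * N - N) - (+ 2 * + d) * N) - + 2 * + d) + + 2 * (N - + 1)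
  Mo-F-closed m d 2≤m rewrite order-F m d =
    trans (cong (λ v → (+ m - + 1) * + v) Mo≡levelSum)
          (trans (levelSum-moAt m d 2≤m d ℕₚ.≤-refl)
                 (closedForm (+ m - + 1) (+ N) (+ (m ^ suc d)) (+ d) (geomSum-closed m (suc d))))
    where
      open Mostar m d 2≤m
      closedForm : ∀ a N M d → a * N ≡ M - + 1 →
        partialMo a N N M d ≡ (a * ((N * N - N) - (+ 2 * d) * N) - + 2 * d) + + 2 * (N - + 1)
      closedForm a N M d aN≡M-1 =
        trans (cong (λ M → partialMo a N N M d) (sym (isolateM a N M aN≡M-1))) (expand a N d)
        where
          isolateM : ∀ a N M → a * N ≡ M - + 1 → a * N + + 1 ≡ M
          isolateM a N M h = trans (cong (_+ + 1) h) (cancel M)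
            where
              cancel : ∀ M → M - + 1 + + 1 ≡ M
              cancel = solve-∀
          expand : ∀ a N d → a * N * (N - + 1) - + 2 * d * (a * N + + 1) + + 2 * (N - + 1)
                             ≡ (a * ((N * N - N) - (+ 2 * d) * N) - + 2 * d) + + 2 * (N - + 1)
          expand = solve-∀

open FullTree using (irr-F)
open MostarIdentity using (order-F-closed; Mo-F-closed)
open import Data.Nat using (ℕ; _≤_; _^_; _+_)
open import Data.Integer using (ℤ; +_; _-_; _*_) renaming (_+_ to _+ℤ_)
open import Data.Product using (_×_; _,_)
open import Relation.Binary.PropositionalEquality using (_≡_)

mainTheorem9 : (m d : ℕ) → 2 ≤ m → 2 ≤ d →
    let N = + order (F m d) in
    (((+ m) - (+ 1)) * N ≡ (+ (m ^ (d + 1))) - (+ 1))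
    × (irr (F m d) ≡ m + m ^ (d + 1))
    × (((+ m) - (+ 1)) * (+ (MoF m d))
        ≡ (((+ m) - (+ 1)) * ((N * N - N) - ((+ 2) * (+ d)) * N)
           - (+ 2) * (+ d)) +ℤ (+ 2) * (N - (+ 1)))
mainTheorem9 m d 2≤m 2≤d = order-F-closed m d , irr-F m d 2≤d , Mo-F-closed m d 2≤m
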